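{- Let $G=N\rtimes H$ be a Frobenius group with kernel $N$ and complement $H$, and put $r=\frac{|N|-1}{|H|}$. Let $T,T'\subset N\setminus\{1\}$ be unions of conjugacy classes of $G$ closed under inverses, and let $U,U'\subset G\setminus N$ be nonempty unions of conjugacy classes of $G$ closed under inverses. Put $a_T=r-\frac{|T|}{|H|}$, $b_U=|H|-1-\frac{|U|}{|N|}$ (and similarly $a_{T'}$, $b_{U'}$). Then $|G|-|T\cup U|=|G|-|T'\cup U'|$ if and only if $(a_T,b_U)=(a_{T'},b_{U'})$.
   Context: A finite group $G$ is a Frobenius group if it has a subgroup $H$ with $1\ne H\ne G$ and $H\cap g^{ -1}Hg=\{1\}$ for all $g\notin H$; the Frobenius kernel $N=\bigl(G\setminus\bigcup_g g^{ -1}Hg\bigr)\cup\{1\}$ is a normal subgroup with $G=N\rtimes H$, and $(|N|-1)/|H|$ is an integer. The quantities $a_T$ and $b_U$ are nonnegative integers (each $G$-class in $N\setminus\{1\}$ has size $|H|$ times an $N$-class size, and each $G$-class outside $N$ has size $|N|$ times an $H$-class size). -}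

module Defs where

open import Data.Nat using (ℕ; zero; suc)
open import Data.Fin using (Fin; _≟_)
open import Data.Fin.Properties using (all?)
open import Data.Fin.Subset using (Subset; _∈_; _∉_; inside; outside)
open import Data.Fin.Subset.Properties using (_∈?_)
open import Data.Vec using (tabulate)
open import Data.Bool using (if_then_else_)
open import Data.Product using (Σ; ∃; _×_; _,_)
open import Data.Sum using (_⊎_)
open import Data.Integer using (ℤ; +_) renaming (_-_ to _-ℤ_)
open import Data.Rational using (ℚ; _/_; 0ℚ) renaming (_-_ to _-ℚ_)
open import Relation.Nullary using (¬_; does)
open import Relation.Nullary.Decidable using (_⊎-dec_; ¬?)
open import Relation.Binary.PropositionalEquality using (_≡_)
open import Algebra.Structures using (IsGroup)

record FinGroup : Set where
  field
    n     : ℕ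
    _·_   : Fin n → Fin n → Fin n
    e     : Fin n
    inv   : Fin n → Fin n
    isGroup : IsGroup _≡_ _·_ e inv
  infixl 7 _·_

  -- conjugate g x g⁻¹ ; note x ∈ g⁻¹ H g  iff  g x g⁻¹ ∈ H
  conj : Fin n → Fin n → Fin n
  conj g x = (g · x) · inv g

  InConjugate : Subset n → Fin n → Fin n → Set
  InConjugate S g x = conj g x ∈ S

  IsSubgroup : Subset n → Set
  IsSubgroup S = (e ∈ S) × (∀ x y → x ∈ S → y ∈ S → (x · y) ∈ S) × (∀ x → x ∈ S → inv x ∈ S)

  IsFrobeniusComplement : Subset n → Set
  IsFrobeniusComplement H =
    IsSubgroup H
    × (∃ λ h → h ∈ H × ¬ (h ≡ e))
    × (∃ λ g → g ∉ H)
    × (∀ g → g ∉ H → ∀ x → x ∈ H → InConjugate H g x → x ≡ e)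

  kernel : Subset n → Subset n
  kernel H = tabulate λ x →
    if does ((x ≟ e) ⊎-dec all? (λ g → ¬? (conj g x ∈? H))) then inside else outside

  ConjClosed : Subset n → Set
  ConjClosed T = ∀ g x → x ∈ T → conj g x ∈ T

  InvClosed : Subset n → Set
  InvClosed T = ∀ x → x ∈ T → inv x ∈ T

-- rational m / d (with the convention m / 0 = 0; only used with d = |H| ≥ 1)
_÷_ : ℤ → ℕ → ℚ
m ÷ zero = 0ℚ
m ÷ suc d = m / suc d

_⊖_ : ℕ → ℕ → ℤ
a ⊖ b = (+ a) -ℤ (+ b)

{-# OPTIONS --safe #-}
-- Let c(x) be the number of g with g x g⁻¹ ∈ H. Counting the pairs (x, g) in two ways gives
-- ∑ c = |G| |H|, while the Frobenius condition forces c(1) = |G|, c = 0 on N ∖ {1} and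
-- c = |H| off N; hence |G| = |H| |N|. For a union U of classes outside N the same double
-- count restricted to U gives |H| |U| = |G| |U ∩ H|, so |N| divides |U|. Since T ⊊ N, the
-- number |T ∪ U| = |T| + |N| (|U| / |N|) determines |T| and |U| as remainder and quotient.
module Submission where

open import Defs
open import Data.Nat using (ℕ; zero; suc; _+_; _*_; _<_; >-nonZero)
open import Data.Nat.Divisibility using (_∣_; divides)
open import Data.Nat.DivMod using (_%_; [m+kn]%n≡m%n; m<n⇒m%n≡m)
import Data.Nat.Properties as ℕ
open import Data.Fin using (Fin; zero; suc; _≟_)
open import Data.Fin.Properties using (all?; ¬∀⟶∃¬)
open import Data.Fin.Subset using (Subset; _∈_; _∉_; _∪_; ∣_∣; Nonempty; inside; outside)
open import Data.Fin.Subset.Properties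
  using (_∈?_; ⊥⊆; ∉⊥; ∣⊥∣≡0; p⊂q⇒∣p∣<∣q∣)
open import Data.Vec using (_∷_; []; tabulate; here; there)
open import Data.Vec.Properties using (lookup∘tabulate; []=⇒lookup; lookup⇒[]=)
open import Data.Bool using (if_then_else_)
open import Data.Product using (_×_; _,_; ∃; proj₁; proj₂)
open import Data.Sum using (_⊎_; inj₁; inj₂)
open import Data.Integer using (+_)
import Data.Integer.Properties as ℤ
open import Data.Rational using (ℚ) renaming (_-_ to _-ℚ_)
import Data.Rational.Properties as ℚ
open import Data.Rational.Unnormalised using (mkℚᵘ; *≡*)
open import Algebra.Bundles using (Group; AbelianGroup)
open import Algebra.Structures using (IsGroup)
import Algebra.Properties.Group as GroupProperties
open import Algebra.Properties.CommutativeMonoid.Sum ℕ.+-0-commutativeMonoid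
  using (sum; ∑-comm; ∑-permute; sum-cong-≗; ∑-distrib-+)
open import Algebra.Properties.Semiring.Sum ℕ.+-*-semiring using (*-distribˡ-sum)
open import Data.Fin.Permutation using (Permutation; permutation)
open import Function.Bundles using (_⇔_; mk⇔; Equivalence)
open import Relation.Nullary using (¬_; Dec; yes; no; does; contradiction)
open import Relation.Nullary.Decidable using (decidable-stable; ¬?; _⊎-dec_)
open import Relation.Binary.PropositionalEquality
  using (_≡_; _≢_; refl; sym; trans; cong; cong₂; subst; module ≡-Reasoning)
open import Level using (0ℓ)
open FinGroup

χ : ∀ {P : Set} → Dec P → ℕ
χ d = if does d then 1 else 0

χ-yes : ∀ {P : Set} (d : Dec P) → P → χ d ≡ 1
χ-yes (yes _) _ = refl
χ-yes (no ¬p) p = contradiction p ¬p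

χ-no : ∀ {P : Set} (d : Dec P) → ¬ P → χ d ≡ 0
χ-no (yes p) ¬p = contradiction p ¬p
χ-no (no _)  _  = refl

χ-cong : ∀ {P Q : Set} (d : Dec P) (d′ : Dec Q) → P ⇔ Q → χ d ≡ χ d′
χ-cong (yes _) (yes _) _   = refl
χ-cong (yes p) (no ¬q) P⇔Q = contradiction (Equivalence.to P⇔Q p) ¬q
χ-cong (no ¬p) (yes q) P⇔Q = contradiction (Equivalence.from P⇔Q q) ¬p
χ-cong (no _)  (no _)  _   = refl

sum-const : ∀ m c → sum {m} (λ _ → c) ≡ m * c
sum-const zero    c = refl
sum-const (suc m) c = cong (λ s → c + s) (sum-const m c)

sum-χ≟ : ∀ {m} (a : Fin m) → sum (λ i → χ (i ≟ a)) ≡ 1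
sum-χ≟ {suc m} zero    = cong suc (trans (sum-const m 0) (ℕ.*-zeroʳ m))
sum-χ≟ {suc m} (suc a) = sum-χ≟ a

∣p∣≡sum-χ : ∀ {m} (p : Subset m) → ∣ p ∣ ≡ sum (λ i → χ (i ∈? p))
∣p∣≡sum-χ []            = refl
∣p∣≡sum-χ (inside  ∷ p) = cong suc (∣p∣≡sum-χ p)
∣p∣≡sum-χ (outside ∷ p) = ∣p∣≡sum-χ p

x∈p⇒∣p∣>0 : ∀ {m x} {p : Subset m} → x ∈ p → 0 < ∣ p ∣
x∈p⇒∣p∣>0 {m} {x} {p} x∈p = subst (_< ∣ p ∣) (∣⊥∣≡0 m) (p⊂q⇒∣p∣<∣q∣ (⊥⊆ , x , x∈p , ∉⊥))

∣p∪q∣≡∣p∣+∣q∣ : ∀ {m} (p q : Subset m) → (∀ {x} → x ∈ p → x ∉ q) → ∣ p ∪ q ∣ ≡ ∣ p ∣ + ∣ q ∣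
∣p∪q∣≡∣p∣+∣q∣ []            []            _        = refl
∣p∪q∣≡∣p∣+∣q∣ (inside  ∷ p) (inside  ∷ q) disjoint = contradiction here (disjoint here)
∣p∪q∣≡∣p∣+∣q∣ (inside  ∷ p) (outside ∷ q) disjoint =
  cong suc (∣p∪q∣≡∣p∣+∣q∣ p q λ x∈p x∈q → disjoint (there x∈p) (there x∈q))
∣p∪q∣≡∣p∣+∣q∣ (outside ∷ p) (inside  ∷ q) disjoint =
  trans (cong suc (∣p∪q∣≡∣p∣+∣q∣ p q λ x∈p x∈q → disjoint (there x∈p) (there x∈q)))
        (sym (ℕ.+-suc ∣ p ∣ ∣ q ∣))
∣p∪q∣≡∣p∣+∣q∣ (outside ∷ p) (outside ∷ q) disjoint =
  ∣p∪q∣≡∣p∣+∣q∣ p q λ x∈p x∈q → disjoint (there x∈p) (there x∈q)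

m+kn-injective : ∀ {n t t′ k k′} → t < n → t′ < n → t + k * n ≡ t′ + k′ * n → t ≡ t′ × k ≡ k′
m+kn-injective {n@(suc _)} {t} {t′} {k} {k′} t<n t′<n eq = t≡t′ , k≡k′
  where
  open ≡-Reasoning
  t≡t′ : t ≡ t′
  t≡t′ = begin
    t                 ≡⟨ sym (m<n⇒m%n≡m t<n) ⟩
    t % n             ≡⟨ sym ([m+kn]%n≡m%n t k n) ⟩
    (t + k * n) % n   ≡⟨ cong (_% n) eq ⟩
    (t′ + k′ * n) % n ≡⟨ [m+kn]%n≡m%n t′ k′ n ⟩
    t′ % n            ≡⟨ m<n⇒m%n≡m t′<n ⟩
    t′                ∎
  k≡k′ : k ≡ k′
  k≡k′ = ℕ.*-cancelʳ-≡ k k′ n (ℕ.+-cancelˡ-≡ t _ _ (trans eq (cong (λ s → s + k′ * n) (sym t≡t′))))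

⊖-injectiveʳ : ∀ m a b → m ⊖ a ≡ m ⊖ b → a ≡ b
⊖-injectiveʳ m a b eq = ℤ.+-injective (ℤG.⁻¹-injective (ℤG.∙-cancelˡ (+ m) _ _ eq))
  where module ℤG = GroupProperties (AbelianGroup.group ℤ.+-0-abelianGroup)

-ℚ-injectiveʳ : ∀ (r a b : ℚ) → r -ℚ a ≡ r -ℚ b → a ≡ b
-ℚ-injectiveʳ r a b eq = ℚG.⁻¹-injective (ℚG.∙-cancelˡ r _ _ eq)
  where module ℚG = GroupProperties ℚ.+-0-group

÷-injective : ∀ {d} a b → 0 < d → (+ a) ÷ d ≡ (+ b) ÷ d → a ≡ b
÷-injective {suc d} a b _ eq with ℚ./-injective-≃ (mkℚᵘ (+ a) d) (mkℚᵘ (+ b) d) eq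
... | *≡* a*d≡b*d = ℤ.+-injective (ℤ.*-cancelʳ-≡ (+ a) (+ b) (+ suc d) a*d≡b*d)

∈-tabulate-does : ∀ {m} {P : Fin m → Set} (P? : ∀ x → Dec (P x)) x →
                  x ∈ tabulate (λ y → if does (P? y) then inside else outside) ⇔ P x
∈-tabulate-does P? x = mk⇔
  (λ x∈p → inside⇒P (P? x) (trans (sym (lookup∘tabulate _ x)) ([]=⇒lookup x∈p)))
  (λ p → lookup⇒[]= x _ (trans (lookup∘tabulate _ x) (P⇒inside (P? x) p)))
  where
  inside⇒P : ∀ {Q : Set} (d : Dec Q) → (if does d then inside else outside) ≡ inside → Q
  inside⇒P (yes q) _ = q
  inside⇒P (no _) ()
  P⇒inside : ∀ {Q : Set} (d : Dec Q) → Q → (if does d then inside else outside) ≡ inside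
  P⇒inside (yes _) _ = refl
  P⇒inside (no ¬q) q = contradiction q ¬q

module Conjugation (G : FinGroup) where
  open FinGroup G using () renaming (n to |G|; _·_ to _∙_; e to ε; inv to _⁻¹)
  open IsGroup (isGroup G) using (assoc; identityˡ; identityʳ; inverseˡ; inverseʳ)
  open ≡-Reasoning

  group : Group 0ℓ 0ℓ
  group = record { isGroup = isGroup G }
  open GroupProperties group using (ε⁻¹≈ε; ⁻¹-anti-homo-∙)

  conj-ε : ∀ g → conj G g ε ≡ ε
  conj-ε g = trans (cong (_∙ g ⁻¹) (identityʳ g)) (inverseʳ g)

  conj-identity : ∀ x → conj G ε x ≡ x
  conj-identity x = trans (cong₂ _∙_ (identityˡ x) ε⁻¹≈ε) (identityʳ x)

  conj-∙ : ∀ g h x → conj G (g ∙ h) x ≡ conj G g (conj G h x)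
  conj-∙ g h x = begin
    ((g ∙ h) ∙ x) ∙ (g ∙ h) ⁻¹    ≡⟨ cong (((g ∙ h) ∙ x) ∙_) (⁻¹-anti-homo-∙ g h) ⟩
    ((g ∙ h) ∙ x) ∙ (h ⁻¹ ∙ g ⁻¹) ≡⟨ sym (assoc _ (h ⁻¹) (g ⁻¹)) ⟩
    (((g ∙ h) ∙ x) ∙ h ⁻¹) ∙ g ⁻¹ ≡⟨ cong (λ y → (y ∙ h ⁻¹) ∙ g ⁻¹) (assoc g h x) ⟩
    ((g ∙ (h ∙ x)) ∙ h ⁻¹) ∙ g ⁻¹ ≡⟨ cong (_∙ g ⁻¹) (assoc g (h ∙ x) (h ⁻¹)) ⟩
    (g ∙ ((h ∙ x) ∙ h ⁻¹)) ∙ g ⁻¹ ∎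

  conj-inverseˡ : ∀ g x → conj G (g ⁻¹) (conj G g x) ≡ x
  conj-inverseˡ g x = trans (sym (conj-∙ (g ⁻¹) g x))
                            (trans (cong (λ h → conj G h x) (inverseˡ g)) (conj-identity x))

  conj-inverseʳ : ∀ g x → conj G g (conj G (g ⁻¹) x) ≡ x
  conj-inverseʳ g x = trans (sym (conj-∙ g (g ⁻¹) x))
                            (trans (cong (λ h → conj G h x) (inverseʳ g)) (conj-identity x))

  conj≡ε⇒≡ε : ∀ g x → conj G g x ≡ ε → x ≡ ε
  conj≡ε⇒≡ε g x eq = trans (sym (conj-inverseˡ g x)) (trans (cong (conj G (g ⁻¹)) eq) (conj-ε (g ⁻¹)))

  ∈-conj⇔∈ : ∀ {S} → ConjClosed G S → ∀ g x → conj G g x ∈ S ⇔ x ∈ S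
  ∈-conj⇔∈ {S} S-closed g x =
    mk⇔ (λ gxg⁻¹∈S → subst (_∈ S) (conj-inverseˡ g x) (S-closed (g ⁻¹) _ gxg⁻¹∈S)) (S-closed g x)

  conjPerm : Fin |G| → Permutation |G| |G|
  conjPerm g = permutation (conj G g) (conj G (g ⁻¹)) (conj-inverseʳ g) (conj-inverseˡ g)

  ∙ʳ-perm : Fin |G| → Permutation |G| |G|
  ∙ʳ-perm a = permutation (_∙ a) (_∙ a ⁻¹) (cancel a (a ⁻¹) (inverseˡ a)) (cancel (a ⁻¹) a (inverseʳ a))
    where
    cancel : ∀ a b → b ∙ a ≡ ε → ∀ x → (x ∙ b) ∙ a ≡ x
    cancel a b b∙a≡ε x = trans (assoc x b a) (trans (cong (x ∙_) b∙a≡ε) (identityʳ x))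

module Counting (G : FinGroup) (H : Subset (n G)) where
  open FinGroup G using () renaming (n to |G|; _·_ to _∙_; e to ε)
  open Conjugation G
  open ≡-Reasoning

  conjugatorCount : Fin |G| → ℕ
  conjugatorCount x = sum (λ g → χ (conj G g x ∈? H))

  conjugatorCount-conj : ∀ a x → conjugatorCount (conj G a x) ≡ conjugatorCount x
  conjugatorCount-conj a x = begin
    sum (λ g → χ (conj G g (conj G a x) ∈? H)) ≡⟨ sum-cong-≗ (λ g → cong (λ y → χ (y ∈? H)) (sym (conj-∙ g a x))) ⟩
    sum (λ g → χ (conj G (g ∙ a) x ∈? H))      ≡⟨ sym (∑-permute (λ g → χ (conj G g x ∈? H)) (∙ʳ-perm a)) ⟩
    conjugatorCount x                          ∎

  ∑-weighted-conjugatorCount : (w : Fin |G| → ℕ) → (∀ g x → w (conj G g x) ≡ w x) →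
    sum (λ x → w x * conjugatorCount x) ≡ |G| * sum (λ y → w y * χ (y ∈? H))
  ∑-weighted-conjugatorCount w w-invariant = begin
    sum (λ x → w x * conjugatorCount x)
      ≡⟨ sum-cong-≗ (λ x → *-distribˡ-sum (w x) (λ g → χ (conj G g x ∈? H))) ⟩
    sum (λ x → sum (λ g → w x * χ (conj G g x ∈? H)))
      ≡⟨ ∑-comm (λ x g → w x * χ (conj G g x ∈? H)) ⟩
    sum (λ g → sum (λ x → w x * χ (conj G g x ∈? H)))
      ≡⟨ sum-cong-≗ inner ⟩
    sum {|G|} (λ _ → W)
      ≡⟨ sum-const |G| W ⟩
    |G| * W ∎
    where
    W : ℕ
    W = sum (λ y → w y * χ (y ∈? H))
    inner : ∀ g → sum (λ x → w x * χ (conj G g x ∈? H)) ≡ W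
    inner g = begin
      sum (λ x → w x * χ (conj G g x ∈? H))
        ≡⟨ sum-cong-≗ (λ x → cong (_* χ (conj G g x ∈? H)) (sym (w-invariant g x))) ⟩
      sum (λ x → w (conj G g x) * χ (conj G g x ∈? H))
        ≡⟨ sym (∑-permute (λ y → w y * χ (y ∈? H)) (conjPerm g)) ⟩
      W ∎

  ∑-conjugatorCount : sum conjugatorCount ≡ |G| * ∣ H ∣
  ∑-conjugatorCount = begin
    sum conjugatorCount                         ≡⟨ sum-cong-≗ (λ x → sym (ℕ.*-identityˡ (conjugatorCount x))) ⟩
    sum (λ x → 1 * conjugatorCount x)           ≡⟨ ∑-weighted-conjugatorCount (λ _ → 1) (λ _ _ → refl) ⟩
    |G| * sum (λ y → 1 * χ (y ∈? H))            ≡⟨ cong (|G| *_) (sum-cong-≗ (λ y → ℕ.*-identityˡ (χ (y ∈? H)))) ⟩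
    |G| * sum (λ y → χ (y ∈? H))                ≡⟨ cong (|G| *_) (sym (∣p∣≡sum-χ H)) ⟩
    |G| * ∣ H ∣                                 ∎

module Frobenius (G : FinGroup) (H : Subset (n G)) (H≤G : IsSubgroup G H)
  (frobenius : ∀ g → g ∉ H → ∀ x → x ∈ H → InConjugate G H g x → x ≡ e G) where
  open FinGroup G using () renaming (n to |G|; _·_ to _∙_; e to ε; inv to _⁻¹)
  open Conjugation G
  open Counting G H
  open ≡-Reasoning

  N : Subset |G|
  N = kernel G H

  |H| |N| : ℕ
  |H| = ∣ H ∣
  |N| = ∣ N ∣

  ∈N⇔ : ∀ x → x ∈ N ⇔ (x ≡ ε ⊎ (∀ g → conj G g x ∉ H))
  ∈N⇔ = ∈-tabulate-does (λ x → (x ≟ ε) ⊎-dec all? (λ g → ¬? (conj G g x ∈? H)))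

  ε∈H : ε ∈ H
  ε∈H = proj₁ H≤G

  ε∈N : ε ∈ N
  ε∈N = Equivalence.from (∈N⇔ ε) (inj₁ refl)

  conj∈H⇔∈H : ∀ {y} → y ∈ H → y ≢ ε → ∀ g → conj G g y ∈ H ⇔ g ∈ H
  conj∈H⇔∈H {y} y∈H y≢ε g = mk⇔
    (λ gyg⁻¹∈H → decidable-stable (g ∈? H) (λ g∉H → y≢ε (frobenius g g∉H y y∈H gyg⁻¹∈H)))
    (λ g∈H → mulH _ _ (mulH g y g∈H y∈H) (invH g g∈H))
    where
    mulH : ∀ a b → a ∈ H → b ∈ H → a ∙ b ∈ H
    mulH = proj₁ (proj₂ H≤G)
    invH : ∀ a → a ∈ H → a ⁻¹ ∈ H
    invH = proj₂ (proj₂ H≤G)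

  conjugatorCount-ε : conjugatorCount ε ≡ |G|
  conjugatorCount-ε = begin
    sum (λ g → χ (conj G g ε ∈? H)) ≡⟨ sum-cong-≗ (λ g → χ-yes (conj G g ε ∈? H) (subst (_∈ H) (sym (conj-ε g)) ε∈H)) ⟩
    sum {|G|} (λ _ → 1)             ≡⟨ sum-const |G| 1 ⟩
    |G| * 1                         ≡⟨ ℕ.*-identityʳ |G| ⟩
    |G|                             ∎

  conjugatorCount-N : ∀ {x} → x ∈ N → x ≢ ε → conjugatorCount x ≡ 0
  conjugatorCount-N {x} x∈N x≢ε with Equivalence.to (∈N⇔ x) x∈N
  ... | inj₁ x≡ε    = contradiction x≡ε x≢ε
  ... | inj₂ never = trans (sum-cong-≗ (λ g → χ-no (conj G g x ∈? H) (never g)))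
                           (trans (sum-const |G| 0) (ℕ.*-zeroʳ |G|))

  conjugatorCount-∉N : ∀ {x} → x ∉ N → conjugatorCount x ≡ |H|
  conjugatorCount-∉N {x} x∉N = begin
    conjugatorCount x          ≡⟨ sym (conjugatorCount-conj g x) ⟩
    conjugatorCount y          ≡⟨ sum-cong-≗ (λ a → χ-cong (conj G a y ∈? H) (a ∈? H) (conj∈H⇔∈H y∈H y≢ε a)) ⟩
    sum (λ a → χ (a ∈? H))     ≡⟨ sym (∣p∣≡sum-χ H) ⟩
    |H|                      ∎
    where
    ∃g : ∃ λ g → ¬ ¬ (conj G g x ∈ H)
    ∃g = ¬∀⟶∃¬ |G| _ (λ g → ¬? (conj G g x ∈? H)) (λ never → x∉N (Equivalence.from (∈N⇔ x) (inj₂ never)))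
    g : Fin |G|
    g = proj₁ ∃g
    y : Fin |G|
    y = conj G g x
    y∈H : y ∈ H
    y∈H = decidable-stable (y ∈? H) (proj₂ ∃g)
    y≢ε : y ≢ ε
    y≢ε y≡ε = x∉N (Equivalence.from (∈N⇔ x) (inj₁ (conj≡ε⇒≡ε g x y≡ε)))

  conjugatorCount-pointwise : ∀ x → conjugatorCount x + |H| * χ (x ∈? N) ≡ |H| + |G| * χ (x ≟ ε)
  conjugatorCount-pointwise x with x ≟ ε | x ∈? N
  ... | yes refl | yes _ = begin
    conjugatorCount ε + |H| * 1 ≡⟨ cong₂ _+_ conjugatorCount-ε (ℕ.*-identityʳ |H|) ⟩
    |G| + |H|                  ≡⟨ ℕ.+-comm |G| |H| ⟩
    |H| + |G|                  ≡⟨ cong (λ s → |H| + s) (sym (ℕ.*-identityʳ |G|)) ⟩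
    |H| + |G| * 1              ∎
  ... | yes refl | no ε∉N = contradiction ε∈N ε∉N
  ... | no x≢ε | yes x∈N = begin
    conjugatorCount x + |H| * 1 ≡⟨ cong₂ _+_ (conjugatorCount-N x∈N x≢ε) (ℕ.*-identityʳ |H|) ⟩
    |H|                        ≡⟨ sym (ℕ.+-identityʳ |H|) ⟩
    |H| + 0                    ≡⟨ cong (λ s → |H| + s) (sym (ℕ.*-zeroʳ |G|)) ⟩
    |H| + |G| * 0              ∎
  ... | no _ | no x∉N = cong₂ _+_ (conjugatorCount-∉N x∉N) (trans (ℕ.*-zeroʳ |H|) (sym (ℕ.*-zeroʳ |G|)))

  |G|≡|H|*|N| : |G| ≡ |H| * |N|
  |G|≡|H|*|N| = sym (ℕ.+-cancelˡ-≡ (|G| * |H|) _ _ (begin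
    |G| * |H| + |H| * |N|
      ≡⟨ cong₂ _+_ (sym ∑-conjugatorCount) (cong (|H| *_) (∣p∣≡sum-χ N)) ⟩
    sum conjugatorCount + |H| * sum (λ x → χ (x ∈? N))
      ≡⟨ cong (λ s → sum conjugatorCount + s) (*-distribˡ-sum |H| (λ x → χ (x ∈? N))) ⟩
    sum conjugatorCount + sum (λ x → |H| * χ (x ∈? N))
      ≡⟨ sym (∑-distrib-+ conjugatorCount (λ x → |H| * χ (x ∈? N))) ⟩
    sum (λ x → conjugatorCount x + |H| * χ (x ∈? N))
      ≡⟨ sum-cong-≗ conjugatorCount-pointwise ⟩
    sum (λ x → |H| + |G| * χ (x ≟ ε))
      ≡⟨ ∑-distrib-+ (λ _ → |H|) (λ x → |G| * χ (x ≟ ε)) ⟩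
    sum {|G|} (λ _ → |H|) + sum (λ x → |G| * χ (x ≟ ε))
      ≡⟨ cong₂ _+_ (sum-const |G| |H|) (sym (*-distribˡ-sum |G| (λ x → χ (x ≟ ε)))) ⟩
    |G| * |H| + |G| * sum (λ x → χ (x ≟ ε))
      ≡⟨ cong (λ s → |G| * |H| + |G| * s) (sum-χ≟ ε) ⟩
    |G| * |H| + |G| * 1
      ≡⟨ cong (λ s → |G| * |H| + s) (ℕ.*-identityʳ |G|) ⟩
    |G| * |H| + |G| ∎))

  ∣N∣∣∣U∣ : ∀ {U} → ConjClosed G U → (∀ x → x ∈ U → x ∉ N) → |N| ∣ (∣ U ∣)
  ∣N∣∣∣U∣ {U} U-closed U∩N≡∅ = divides k (ℕ.*-cancelˡ-≡ ∣ U ∣ (k * |N|) |H| {{>-nonZero (x∈p⇒∣p∣>0 ε∈H)}} (begin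
    |H| * ∣ U ∣                                 ≡⟨ cong (|H| *_) (∣p∣≡sum-χ U) ⟩
    |H| * sum (λ x → χ (x ∈? U))                ≡⟨ *-distribˡ-sum |H| (λ x → χ (x ∈? U)) ⟩
    sum (λ x → |H| * χ (x ∈? U))                ≡⟨ sum-cong-≗ pointwise ⟩
    sum (λ x → χ (x ∈? U) * conjugatorCount x)    ≡⟨ ∑-weighted-conjugatorCount (λ x → χ (x ∈? U)) invariant ⟩
    |G| * k                                        ≡⟨ cong (_* k) |G|≡|H|*|N| ⟩
    |H| * |N| * k                              ≡⟨ ℕ.*-assoc |H| |N| k ⟩
    |H| * (|N| * k)                            ≡⟨ cong (|H| *_) (ℕ.*-comm |N| k) ⟩
    |H| * (k * |N|)                            ∎))
    where
    k : ℕ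
    k = sum (λ y → χ (y ∈? U) * χ (y ∈? H))
    invariant : ∀ g x → χ (conj G g x ∈? U) ≡ χ (x ∈? U)
    invariant g x = χ-cong (conj G g x ∈? U) (x ∈? U) (∈-conj⇔∈ U-closed g x)
    pointwise : ∀ x → |H| * χ (x ∈? U) ≡ χ (x ∈? U) * conjugatorCount x
    pointwise x with x ∈? U
    ... | yes x∈U = trans (ℕ.*-identityʳ |H|) (sym (trans (ℕ.+-identityʳ _) (conjugatorCount-∉N (U∩N≡∅ x x∈U))))
    ... | no _    = ℕ.*-zeroʳ |H|

  ∣T∣<∣N∣ : ∀ {T} → (∀ x → x ∈ T → x ∈ N × x ≢ ε) → ∣ T ∣ < |N|
  ∣T∣<∣N∣ T⊆N∖ε = p⊂q⇒∣p∣<∣q∣ ((λ {x} x∈T → proj₁ (T⊆N∖ε x x∈T)) , ε , ε∈N , λ ε∈T → proj₂ (T⊆N∖ε ε ε∈T) refl)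

  ∣T∪U∣≡∣T∣+∣U∣ : ∀ {T U} → (∀ x → x ∈ T → x ∈ N × x ≢ ε) → (∀ x → x ∈ U → x ∉ N) →
                  ∣ T ∪ U ∣ ≡ ∣ T ∣ + ∣ U ∣
  ∣T∪U∣≡∣T∣+∣U∣ {T} {U} T⊆N∖ε U∩N≡∅ =
    ∣p∪q∣≡∣p∣+∣q∣ T U (λ {x} x∈T x∈U → U∩N≡∅ x x∈U (proj₁ (T⊆N∖ε x x∈T)))

  ∣T∪U∣-injective : ∀ {T T′ U U′} →
    (∀ x → x ∈ T → x ∈ N × x ≢ ε) → (∀ x → x ∈ T′ → x ∈ N × x ≢ ε) →
    (∀ x → x ∈ U → x ∉ N) → ConjClosed G U → (∀ x → x ∈ U′ → x ∉ N) → ConjClosed G U′ →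
    ∣ T ∪ U ∣ ≡ ∣ T′ ∪ U′ ∣ → ∣ T ∣ ≡ ∣ T′ ∣ × ∣ U ∣ ≡ ∣ U′ ∣
  ∣T∪U∣-injective {T} {T′} {U} {U′} T⊆N∖ε T′⊆N∖ε U∩N≡∅ U-closed U′∩N≡∅ U′-closed eq
    with ∣N∣∣∣U∣ U-closed U∩N≡∅ | ∣N∣∣∣U∣ U′-closed U′∩N≡∅
  ... | divides q ∣U∣≡q|N| | divides q′ ∣U′∣≡q′|N|
    with m+kn-injective {k = q} {k′ = q′} (∣T∣<∣N∣ T⊆N∖ε) (∣T∣<∣N∣ T′⊆N∖ε) (begin
           ∣ T ∣ + q * |N|     ≡⟨ cong (λ s → ∣ T ∣ + s) (sym ∣U∣≡q|N|) ⟩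
           ∣ T ∣ + ∣ U ∣       ≡⟨ sym (∣T∪U∣≡∣T∣+∣U∣ T⊆N∖ε U∩N≡∅) ⟩
           ∣ T ∪ U ∣           ≡⟨ eq ⟩
           ∣ T′ ∪ U′ ∣         ≡⟨ ∣T∪U∣≡∣T∣+∣U∣ T′⊆N∖ε U′∩N≡∅ ⟩
           ∣ T′ ∣ + ∣ U′ ∣     ≡⟨ cong (λ s → ∣ T′ ∣ + s) ∣U′∣≡q′|N| ⟩
           ∣ T′ ∣ + q′ * |N|   ∎)
  ... | ∣T∣≡∣T′∣ , q≡q′ = ∣T∣≡∣T′∣ , trans ∣U∣≡q|N| (trans (cong (_* |N|) q≡q′) (sym ∣U′∣≡q′|N|))

lemma3p2 : (G : FinGroup) (H : Subset (n G)) → IsFrobeniusComplement G H →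
    (T T′ U U′ : Subset (n G)) →
    (∀ x → x ∈ T → x ∈ kernel G H × ¬ (x ≡ e G)) → ConjClosed G T → InvClosed G T →
    (∀ x → x ∈ T′ → x ∈ kernel G H × ¬ (x ≡ e G)) → ConjClosed G T′ → InvClosed G T′ →
    (∀ x → x ∈ U → x ∉ kernel G H) → Nonempty U → ConjClosed G U → InvClosed G U →
    (∀ x → x ∈ U′ → x ∉ kernel G H) → Nonempty U′ → ConjClosed G U′ → InvClosed G U′ →
    let NN = ∣ kernel G H ∣
        HH = ∣ H ∣
        r = (NN ⊖ 1) ÷ HH
        aT = r -ℚ ((+ ∣ T ∣) ÷ HH)
        aT′ = r -ℚ ((+ ∣ T′ ∣) ÷ HH)
        bU = (HH ⊖ 1) ÷ 1 -ℚ ((+ ∣ U ∣) ÷ NN)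
        bU′ = (HH ⊖ 1) ÷ 1 -ℚ ((+ ∣ U′ ∣) ÷ NN)
    in ((n G ⊖ ∣ T ∪ U ∣) ≡ (n G ⊖ ∣ T′ ∪ U′ ∣)) ⇔ ((aT , bU) ≡ (aT′ , bU′))
lemma3p2 G H (H≤G , _ , _ , frobenius) T T′ U U′ T⊆N∖ε _ _ T′⊆N∖ε _ _
         U∩N≡∅ _ U-closed _ U′∩N≡∅ _ U′-closed _ = mk⇔ sizes⇒invariants invariants⇒sizes
  where
  open Frobenius G H H≤G frobenius
  r s : ℚ
  r = (|N| ⊖ 1) ÷ |H|
  s = (|H| ⊖ 1) ÷ 1

  sizes⇒invariants : n G ⊖ ∣ T ∪ U ∣ ≡ n G ⊖ ∣ T′ ∪ U′ ∣ →
    (r -ℚ ((+ ∣ T ∣) ÷ |H|) , s -ℚ ((+ ∣ U ∣) ÷ |N|)) ≡ (r -ℚ ((+ ∣ T′ ∣) ÷ |H|) , s -ℚ ((+ ∣ U′ ∣) ÷ |N|))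
  sizes⇒invariants eq
    with ∣T∪U∣-injective T⊆N∖ε T′⊆N∖ε U∩N≡∅ U-closed U′∩N≡∅ U′-closed (⊖-injectiveʳ (n G) _ _ eq)
  ... | ∣T∣≡∣T′∣ , ∣U∣≡∣U′∣ =
    cong₂ _,_ (cong (λ t → r -ℚ ((+ t) ÷ |H|)) ∣T∣≡∣T′∣) (cong (λ u → s -ℚ ((+ u) ÷ |N|)) ∣U∣≡∣U′∣)

  invariants⇒sizes :
    (r -ℚ ((+ ∣ T ∣) ÷ |H|) , s -ℚ ((+ ∣ U ∣) ÷ |N|)) ≡ (r -ℚ ((+ ∣ T′ ∣) ÷ |H|) , s -ℚ ((+ ∣ U′ ∣) ÷ |N|)) →
    n G ⊖ ∣ T ∪ U ∣ ≡ n G ⊖ ∣ T′ ∪ U′ ∣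
  invariants⇒sizes eq = cong (n G ⊖_) (begin
    ∣ T ∪ U ∣         ≡⟨ ∣T∪U∣≡∣T∣+∣U∣ T⊆N∖ε U∩N≡∅ ⟩
    ∣ T ∣ + ∣ U ∣     ≡⟨ cong₂ _+_ ∣T∣≡∣T′∣ ∣U∣≡∣U′∣ ⟩
    ∣ T′ ∣ + ∣ U′ ∣   ≡⟨ sym (∣T∪U∣≡∣T∣+∣U∣ T′⊆N∖ε U′∩N≡∅) ⟩
    ∣ T′ ∪ U′ ∣       ∎)
    where
    open ≡-Reasoning
    ∣T∣≡∣T′∣ : ∣ T ∣ ≡ ∣ T′ ∣
    ∣T∣≡∣T′∣ = ÷-injective _ _ (x∈p⇒∣p∣>0 ε∈H) (-ℚ-injectiveʳ r _ _ (cong proj₁ eq))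
    ∣U∣≡∣U′∣ : ∣ U ∣ ≡ ∣ U′ ∣
    ∣U∣≡∣U′∣ = ÷-injective _ _ (x∈p⇒∣p∣>0 ε∈N) (-ℚ-injectiveʳ s _ _ (cong proj₂ eq))
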